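{- Let $\kappa$ be an infinite cardinal and let $\mathbb{B}$ be a $\langle\kappa,2\rangle$-distributive complete Boolean algebra. Then every $\kappa$-quasiregular filter on $\mathbb{B}$ is $\kappa$-regular.
   Context: A complete Boolean algebra $\mathbb{B}$ is $\langle\kappa,\lambda\rangle$-distributive iff for every function $b\colon\kappa\times\lambda\to\mathbb{B}$, $\bigwedge_{\alpha<\kappa}\bigvee_{\beta<\lambda}b(\alpha,\beta)=\bigvee_{f\in{}^{\kappa}\lambda}\bigwedge_{\alpha<\kappa}b(\alpha,f(\alpha))$. A maximal antichain of $\mathbb{B}$ is a set of nonzero pairwise disjoint elements with join $\mathbbm{1}$. A filter $F$ on $\mathbb{B}$ is $\kappa$-regular iff there exist a family $\{x_\alpha : \alpha<\kappa\}\subseteq F$ and a maximal antichain $A\subset\mathbb{B}$ such that: for every $\alpha<\kappa$ and $a\in A$, either $a\le x_\alpha$ or $a\wedge x_\alpha=\mathbbm{0}$; and for every $a\in A$ the set $\{\alpha<\kappa : a\le x_\alpha\}$ is finite. $F$ is $\kappa$-quasiregular iff there is a family $\{x_\alpha : \alpha<\kappa\}\subseteq F$ such that $\bigwedge_{\alpha\in I}x_\alpha=\mathbbm{0}$ for every infinite $I\subseteq\kappa$. -}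

module Defs where

open import Level using (Level; Lift; lift; _⊔_) renaming (suc to lsuc)
open import Data.Bool using (Bool; true; false)
open import Data.List using (List)
open import Data.List.Membership.Propositional using (_∈_)
open import Data.Product using (Σ; ∃; _×_; _,_; proj₁)
open import Data.Sum using (_⊎_)
open import Data.Unit.Polymorphic using () renaming (⊤ to ⊤ᵤ)
open import Relation.Nullary using () renaming (¬_ to Not)
open import Algebra.Lattice.Bundles using (BooleanAlgebra)

Finite : ∀ {ℓ} {K : Set ℓ} → (K → Set ℓ) → Set ℓ
Finite {K = K} I = ∃ λ (xs : List K) → ∀ α → I α → α ∈ xs

Infinite : ∀ {ℓ} {K : Set ℓ} → (K → Set ℓ) → Set ℓ
Infinite I = Not (Finite I)

-- A type (playing the role of the cardinal κ) is infinite.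
InfiniteType : ∀ {ℓ} → Set ℓ → Set ℓ
InfiniteType {ℓ} K = Infinite {ℓ} {K} (λ _ → ⊤ᵤ)

-- A complete Boolean algebra: a Boolean algebra (carrier and equality at
-- level ℓ) with joins and meets of all families indexed by types in Set ℓ
-- (in particular of all subsets of the carrier).
record CompleteBooleanAlgebra (ℓ : Level) : Set (lsuc ℓ) where
  field
    booleanAlgebra : BooleanAlgebra ℓ ℓ
  open BooleanAlgebra booleanAlgebra public

  _≤_ : Carrier → Carrier → Set ℓ
  x ≤ y = (x ∧ y) ≈ x

  field
    ⋁ : {I : Set ℓ} → (I → Carrier) → Carrier
    ⋁-upper : {I : Set ℓ} (f : I → Carrier) (i : I) → f i ≤ ⋁ f
    ⋁-least : {I : Set ℓ} (f : I → Carrier) (u : Carrier) → (∀ i → f i ≤ u) → ⋁ f ≤ u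
    ⋀ : {I : Set ℓ} → (I → Carrier) → Carrier
    ⋀-lower : {I : Set ℓ} (f : I → Carrier) (i : I) → ⋀ f ≤ f i
    ⋀-greatest : {I : Set ℓ} (f : I → Carrier) (l : Carrier) → (∀ i → l ≤ f i) → l ≤ ⋀ f

module _ {ℓ : Level} (𝔹 : CompleteBooleanAlgebra ℓ) where
  open CompleteBooleanAlgebra 𝔹

  -- ⟨κ,λ⟩-distributivity, for κ given by the type K and λ by the type L.
  Distributive : (K L : Set ℓ) → Set ℓ
  Distributive K L = (b : K → L → Carrier) →
    ⋀ (λ α → ⋁ (λ β → b α β)) ≈ ⋁ (λ (f : K → L) → ⋀ (λ α → b α (f α)))

  Two : Set ℓ
  Two = Lift ℓ Bool

  record IsFilter (F : Carrier → Set ℓ) : Set ℓ where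
    field
      has-⊤ : F ⊤
      upward : ∀ {x y} → F x → x ≤ y → F y
      meet : ∀ {x y} → F x → F y → F (x ∧ y)
      proper : Not (F ⊥)

  MaximalAntichain : (Carrier → Set ℓ) → Set ℓ
  MaximalAntichain A =
    (∀ a → A a → Not (a ≈ ⊥)) ×
    (∀ a b → A a → A b → Not (a ≈ b) → (a ∧ b) ≈ ⊥) ×
    (⋁ (λ (p : Σ Carrier A) → proj₁ p) ≈ ⊤)

  Regular : (K : Set ℓ) → (Carrier → Set ℓ) → Set (lsuc ℓ)
  Regular K F = ∃ λ (x : K → Carrier) → (∀ α → F (x α)) ×
    ∃ λ (A : Carrier → Set ℓ) → MaximalAntichain A ×
      (∀ α a → A a → (a ≤ x α) ⊎ ((a ∧ x α) ≈ ⊥)) ×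
      (∀ a → A a → Finite (λ α → a ≤ x α))

  Quasiregular : (K : Set ℓ) → (Carrier → Set ℓ) → Set (lsuc ℓ)
  Quasiregular K F = ∃ λ (x : K → Carrier) → (∀ α → F (x α)) ×
    (∀ (I : K → Set ℓ) → Infinite I → ⋀ (λ (p : Σ K I) → x (proj₁ p)) ≈ ⊥)

module Submission where

-- Let x : K → 𝔹 witness κ-quasiregularity of F.  Every sign
-- pattern f : K → 2 determines a "cell"  ⋀_α ±x_α  (x_α where f α = 1,
-- ¬x_α where f α = 0).  Cells of different patterns are disjoint, and every
-- cell decides every x_α (it lies below x_α or is disjoint from it).
-- ⟨κ,2⟩-distributivity, applied to the trivial identity ⋀_α (x_α ∨ ¬x_α) = 1,
-- says exactly that the cells cover 1, so the nonzero cells form a maximal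
-- antichain A.  Finally a nonzero cell a lies below only finitely many x_α:
-- otherwise a ≤ ⋀_{α∈I} x_α = 0 for an infinite I, by quasiregularity.
-- Hence the same family x, together with A, witnesses κ-regularity.

open import Defs
open import Level using (Level; lift)
open import Axiom.ExcludedMiddle using (ExcludedMiddle)
open import Data.Bool using (true; false)
open import Data.Product using (Σ; ∃; _×_; _,_; proj₁; proj₂)
open import Data.Sum using (_⊎_; inj₁; inj₂)
open import Data.Empty using (⊥-elim)
open import Relation.Nullary using (yes; no) renaming (¬_ to Not)
open import Relation.Binary.PropositionalEquality using (_≡_; _≢_)
import Relation.Binary.PropositionalEquality as ≡
import Relation.Binary.Lattice.Bundles as OrderLattice
import Relation.Binary.Lattice.Properties.MeetSemilattice as MeetSemilatticeProperties
import Algebra.Lattice.Properties.Lattice as LatticeProperties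
import Algebra.Lattice.Properties.BooleanAlgebra as BooleanAlgebraProperties

-- The order  x ≤ y ⇔ x ∧ y ≈ x  of Defs is, up to symmetry of ≈, the natural
-- order for which the library proves the order-theoretic lattice laws; each
-- fact below transports one of them.
module LatticeOrder {ℓ : Level} (𝔹 : CompleteBooleanAlgebra ℓ) where
  open CompleteBooleanAlgebra 𝔹
  open BooleanAlgebraProperties booleanAlgebra using (∧-zeroˡ; ∧-identityˡ)
  private
    module O = OrderLattice.Lattice
      (LatticeProperties.∨-∧-orderTheoreticLattice lattice)
    open MeetSemilatticeProperties O.meetSemilattice using (∧-monotonic)

  ≤-reflexive : ∀ {x y} → x ≈ y → x ≤ y
  ≤-reflexive e = sym (O.reflexive e)

  ≤-refl : ∀ {x} → x ≤ x
  ≤-refl = ≤-reflexive refl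

  ≤-trans : ∀ {x y z} → x ≤ y → y ≤ z → x ≤ z
  ≤-trans p q = sym (O.trans (sym p) (sym q))

  ≤-antisym : ∀ {x y} → x ≤ y → y ≤ x → x ≈ y
  ≤-antisym p q = O.antisym (sym p) (sym q)

  ∧-mono : ∀ {a b x y} → a ≤ x → b ≤ y → (a ∧ b) ≤ (x ∧ y)
  ∧-mono p q = sym (∧-monotonic (sym p) (sym q))

  ∨-least : ∀ {x y u} → x ≤ u → y ≤ u → (x ∨ y) ≤ u
  ∨-least p q = sym (O.∨-least (sym p) (sym q))

  ⊥-least : ∀ u → ⊥ ≤ u
  ⊥-least = ∧-zeroˡ

  ≤⊥⇒≈⊥ : ∀ {a} → a ≤ ⊥ → a ≈ ⊥
  ≤⊥⇒≈⊥ p = ≤-antisym p (⊥-least _)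

  ⊤≤⇒≈⊤ : ∀ {u} → ⊤ ≤ u → u ≈ ⊤
  ⊤≤⇒≈⊤ {u} p = trans (sym (∧-identityˡ u)) p

module Cells {ℓ : Level} (𝔹 : CompleteBooleanAlgebra ℓ)
             {K : Set ℓ} (x : K → CompleteBooleanAlgebra.Carrier 𝔹) where
  open CompleteBooleanAlgebra 𝔹
  open LatticeOrder 𝔹

  Sign : Set ℓ
  Sign = Two 𝔹

  literal : K → Sign → Carrier
  literal α (lift true)  = x α
  literal α (lift false) = ¬ x α

  cell : (K → Sign) → Carrier
  cell f = ⋀ (λ α → literal α (f α))

  cell≤literal : ∀ f α → cell f ≤ literal α (f α)
  cell≤literal f α = ⋀-lower (λ β → literal β (f β)) α

  literals-disjoint : ∀ α {s t} → s ≢ t → (literal α s ∧ literal α t) ≈ ⊥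
  literals-disjoint α {lift true}  {lift true}  s≢t = ⊥-elim (s≢t ≡.refl)
  literals-disjoint α {lift true}  {lift false} _   = ∧-complementʳ (x α)
  literals-disjoint α {lift false} {lift true}  _   = ∧-complementˡ (x α)
  literals-disjoint α {lift false} {lift false} s≢t = ⊥-elim (s≢t ≡.refl)

  cells-disjoint : ∀ f g α → f α ≢ g α → (cell f ∧ cell g) ≈ ⊥
  cells-disjoint f g α fα≢gα = ≤⊥⇒≈⊥ (≤-trans
    (∧-mono (cell≤literal f α) (cell≤literal g α))
    (≤-reflexive (literals-disjoint α fα≢gα)))

  -- Pointwise equal patterns have the same cell (there is no function
  -- extensionality, so this is not a matter of rewriting).
  cell-mono : ∀ f g → (∀ α → f α ≡ g α) → cell f ≤ cell g
  cell-mono f g f≗g = ⋀-greatest _ _ λ α →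
    ≡.subst (λ s → cell f ≤ literal α s) (f≗g α) (cell≤literal f α)

  cell-cong : ∀ f g → (∀ α → f α ≡ g α) → cell f ≈ cell g
  cell-cong f g f≗g = ≤-antisym (cell-mono f g f≗g)
                                (cell-mono g f (λ α → ≡.sym (f≗g α)))

  cell-decides : ∀ f α → (cell f ≤ x α) ⊎ ((cell f ∧ x α) ≈ ⊥)
  cell-decides f α with f α | cell≤literal f α
  ... | lift true  | below = inj₁ below
  ... | lift false | below = inj₂ (≤⊥⇒≈⊥ (≤-trans (∧-mono below ≤-refl)
                                                   (≤-reflexive (∧-complementˡ (x α)))))

  -- ⟨K,2⟩-distributivity applied to ⋀_α (x α ∨ ¬ x α) = 1: the cells cover 1.
  cells-cover : Distributive 𝔹 K Sign → ∀ u → (∀ f → cell f ≤ u) → u ≈ ⊤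
  cells-cover distributive u cells≤u = ⊤≤⇒≈⊤
    (≤-trans (⋀-greatest _ ⊤ excluded-middle)          -- ⊤ ≤ ⋀_α ⋁_s literal α s
    (≤-trans (≤-reflexive (distributive literal))      --   ≈ ⋁_f cell f
             (⋁-least cell u cells≤u)))                --   ≤ u
    where
    excluded-middle : ∀ α → ⊤ ≤ ⋁ (literal α)
    excluded-middle α = ≤-trans (≤-reflexive (sym (∨-complementʳ (x α))))
      (∨-least (⋁-upper (literal α) (lift true)) (⋁-upper (literal α) (lift false)))

  -- Classically, cells that differ are disjoint: differing cells must come
  -- from patterns that differ at some index.
  distinct-cells-disjoint : ExcludedMiddle ℓ →
    ∀ f g → Not (cell f ≈ cell g) → (cell f ∧ cell g) ≈ ⊥
  distinct-cells-disjoint lem f g cf≉cg with lem {∃ λ α → f α ≢ g α}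
  ... | yes (α , fα≢gα) = cells-disjoint f g α fα≢gα
  ... | no patterns-agree = ⊥-elim (cf≉cg (cell-cong f g f≗g))
    where
    f≗g : ∀ α → f α ≡ g α
    f≗g α with lem {f α ≡ g α}
    ... | yes fα≡gα = fα≡gα
    ... | no fα≢gα = ⊥-elim (patterns-agree (α , fα≢gα))

  NonzeroCell : Carrier → Set ℓ
  NonzeroCell a = (∃ λ f → a ≈ cell f) × Not (a ≈ ⊥)

  nonzero-cells-decide : ∀ α a → NonzeroCell a → (a ≤ x α) ⊎ ((a ∧ x α) ≈ ⊥)
  nonzero-cells-decide α a ((f , a≈cf) , _) with cell-decides f α
  ... | inj₁ cf≤xα   = inj₁ (≤-trans (≤-reflexive a≈cf) cf≤xα)
  ... | inj₂ cf∧xα≈⊥ = inj₂ (trans (∧-congʳ a≈cf) cf∧xα≈⊥)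

  -- Dropping the zero cells does not change the join, so the nonzero cells
  -- still cover 1.
  nonzero-cells-cover : ExcludedMiddle ℓ → Distributive 𝔹 K Sign →
    ⋁ (λ (a : Σ Carrier NonzeroCell) → proj₁ a) ≈ ⊤
  nonzero-cells-cover lem distributive = cells-cover distributive _ cell≤join
    where
    cell≤join : ∀ f → cell f ≤ ⋁ (λ (a : Σ Carrier NonzeroCell) → proj₁ a)
    cell≤join f with lem {cell f ≈ ⊥}
    ... | yes cf≈⊥ = ≤-trans (≤-reflexive cf≈⊥) (⊥-least _)
    ... | no cf≉⊥ = ⋁-upper proj₁ (cell f , (f , refl) , cf≉⊥)

  nonzero-cells-antichain : ExcludedMiddle ℓ → Distributive 𝔹 K Sign →
    MaximalAntichain 𝔹 NonzeroCell
  nonzero-cells-antichain lem distributive =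
    (λ _ → proj₂) , disjoint , nonzero-cells-cover lem distributive
    where
    disjoint : ∀ a c → NonzeroCell a → NonzeroCell c → Not (a ≈ c) → (a ∧ c) ≈ ⊥
    disjoint a c ((f , a≈cf) , _) ((g , c≈cg) , _) a≉c =
      trans (∧-cong a≈cf c≈cg)
        (distinct-cells-disjoint lem f g
          (λ cf≈cg → a≉c (trans a≈cf (trans cf≈cg (sym c≈cg)))))

  -- If all infinite subfamilies of x meet to 0 (quasiregularity), a nonzero
  -- element lies below only finitely many members of x: it lies below the
  -- meet of those it is below.
  finitely-many-above : ExcludedMiddle ℓ →
    (∀ (I : K → Set ℓ) → Infinite I → ⋀ (λ (p : Σ K I) → x (proj₁ p)) ≈ ⊥) →
    ∀ a → Not (a ≈ ⊥) → Finite (λ α → a ≤ x α)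
  finitely-many-above lem quasiregular a a≉⊥ with lem {Finite (λ α → a ≤ x α)}
  ... | yes finite = finite
  ... | no infinite = ⊥-elim (a≉⊥ (≤⊥⇒≈⊥ (≤-trans
    (⋀-greatest _ a proj₂) (≤-reflexive (quasiregular _ infinite)))))

-- The quasiregularity family itself, with the nonzero cells of it as the
-- antichain, witnesses regularity.
mainTheorem5 : ∀ {ℓ : Level} → ExcludedMiddle ℓ →
    (K : Set ℓ) → InfiniteType K →
    (𝔹 : CompleteBooleanAlgebra ℓ) → Distributive 𝔹 K (Two 𝔹) →
    (F : CompleteBooleanAlgebra.Carrier 𝔹 → Set ℓ) → IsFilter 𝔹 F →
    Quasiregular 𝔹 K F → Regular 𝔹 K F
mainTheorem5 lem K _ 𝔹 distributive F _ (x , x∈F , quasiregular) =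
  x , x∈F , NonzeroCell ,
  nonzero-cells-antichain lem distributive ,
  nonzero-cells-decide ,
  (λ a (_ , a≉⊥) → finitely-many-above lem quasiregular a a≉⊥)
  where open Cells 𝔹 x
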